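{- Let $x \geq 1$, $k \geq 2$, $i \in \{ -1,0, 1\}$ be integers and $n$ an integer with $n + i \geq k + 2$, and suppose $\max\{n + i, 16x\} < 2^{ck}$ for some $c \in (0, 0.25)$. Then \[ \left(L_{n+i}^{(k)}\right)^x = 3^x\cdot 2^{(n+i-2)x} \left(1 + \xi_{n+i} \right), \] where the real number $\xi_{n+i}$ (defined by this equation) satisfies \[ |\xi_{n+i}| <\frac{2}{2^{(1-2c)k}}. \]
   Context: For an integer $k\ge 2$, the $k$-generalized Lucas sequence $(L_n^{(k)})_{n\ge 2-k}$ is defined by $L_0^{(k)}=2$, $L_1^{(k)}=1$, $L_{2-k}^{(k)}=\cdots=L_{ -1}^{(k)}=0$ when $k\ge 3$ (and $L_{ -1}^{(2)}=-1$), and $L_n^{(k)}=L_{n-1}^{(k)}+\cdots+L_{n-k}^{(k)}$ for $n\ge 2$.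
   Formalization: The parameter $c$ ranges over the rationals in $(0, 0.25)$ rather than over all real numbers in that interval. -}

module Defs where

open import Data.Nat using (ℕ; zero; suc; _+_)
open import Data.List using (List; []; _∷_; take)
open import Data.Nat.ListAction using (sum)
open import Data.Integer using (ℤ; +_)
open import Data.Rational using (ℚ; _/_; 1ℚ; _*_)

-- Reversed list of values [L_n, L_{n-1}, ..., L_0] of the k-generalized
-- Lucas sequence.  For n ≥ 2, L_n is the sum of the (at most) k most recent
-- values; the missing terms with negative index are 0 for k ≥ 3, and for
-- k = 2 no negative index is ever reached (n - 2 ≥ 0), so L_{-1}^{(2)} = -1
-- plays no role for n ≥ 0.
step : ℕ → List ℕ → List ℕ
step k ls = sum (take k ls) ∷ ls

lucasRev : ℕ → ℕ → List ℕ
lucasRev k zero = 2 ∷ []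
lucasRev k (suc zero) = 1 ∷ 2 ∷ []
lucasRev k (suc (suc m)) = step k (lucasRev k (suc m))

headOr0 : List ℕ → ℕ
headOr0 [] = 0
headOr0 (x ∷ _) = x

L : ℕ → ℕ → ℕ
L k n = headOr0 (lucasRev k n)

toℚ : ℕ → ℚ
toℚ m = + m / 1

_^ℚ_ : ℚ → ℕ → ℚ
r ^ℚ zero = 1ℚ
r ^ℚ suc m = r * (r ^ℚ m)

-- Up to index k the recurrence just doubles, so L_n = 3 · 2^(n-2) for 2 ≤ n ≤ k.
-- Beyond k it reads L_{n+1} = 2 L_n - L_{n-k}, so the deficit E_n = 3 · 2^(n-2) - L_n
-- obeys E_{n+1} = 2 E_n + L_{n-k} with L_{n-k} ≤ 2^(n-k+1), whence E_n ≤ (n-k) 2^(n-k):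
-- the relative error of L_n is at most n / 2^(k-1).  Raising to the x-th power
-- multiplies the relative error by at most x (Bernoulli), and x n < 2^(2ck)
-- because 16x and n are both below 2^(ck).

module Submission where

open import Data.Integer using (ℤ; +_; -[1+_]; ∣_∣; +≤+; +<+)
  renaming (_+_ to _+ℤ_; _≤_ to _≤ℤ_; _<_ to _<ℤ_)
import Data.Integer.Properties as ℤ
open import Data.List.Base using (List; []; _∷_; take; drop; length)
open import Data.List.Properties using (drop-all)
open import Data.Nat using (ℕ; zero; suc; _+_; _*_; _∸_; _^_; _≤_; _<_; _≥_; z≤n; s≤s)
open import Data.Nat.Coprimality using (1-coprimeTo) renaming (sym to coprime-sym)
open import Data.Nat.ListAction using (sum)
open import Data.Nat.Properties
open import Algebra.Properties.CommutativeSemigroup *-commutativeSemigroup using (interchange)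
open import Data.Nat.Tactic.RingSolver using (solve-∀)
open import Data.Product using (Σ; _×_; _,_; ∃-syntax)
open import Data.Rational
  using (ℚ; mkℚ; _/_; 0ℚ; 1ℚ; -_; 1/_; *≤*; *<*; NonZero; Positive; nonNegative; positive)
  renaming (_+_ to _+ℚ_; _*_ to _*ℚ_; _≤_ to _≤ℚ_; _<_ to _<ℚ_; ∣_∣ to ∣_∣ℚ)
import Data.Rational.Properties as ℚ
open import Data.Rational.Solver using (module +-*-Solver)
open import Data.Sum using (_⊎_)
open import Defs
open import Relation.Binary.PropositionalEquality
  using (_≡_; refl; sym; trans; cong; subst; subst₂; module ≡-Reasoning)

sum-take-suc : ∀ j (xs : List ℕ) → sum (take (suc j) xs) ≡ sum (take j xs) + headOr0 (drop j xs)
sum-take-suc zero    []       = refl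
sum-take-suc (suc j) []       = refl
sum-take-suc zero    (x ∷ xs) = +-identityʳ x
sum-take-suc (suc j) (x ∷ xs) = trans (cong (_+_ x) (sum-take-suc j xs)) (sym (+-assoc x _ _))

^-distribʳ-* : ∀ m n o → (m * n) ^ o ≡ m ^ o * n ^ o
^-distribʳ-* m n zero    = refl
^-distribʳ-* m n (suc o) = trans (cong (m * n *_) (^-distribʳ-* m n o)) (interchange m n (m ^ o) (n ^ o))

^-<-square : ∀ {a b c} q → a ^ q < c → b ^ q < c → (a * b) ^ q < c * c
^-<-square {a} {b} q aᵠ<c bᵠ<c = subst (_< _) (sym (^-distribʳ-* a b q)) (*-mono-< aᵠ<c bᵠ<c)

-- Bernoulli, without division: if l = t (1 - η) with η ≤ M / K, then
-- l^x = t^x (1 - η′) with η′ ≤ x M / K.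
^-deficit : ∀ {l e t K M} x → l + e ≡ t → e * K ≤ M * t →
  ∃[ D ] l ^ x + D ≡ t ^ x × D * K ≤ x * M * t ^ x
^-deficit zero    _    _     = 0 , refl , z≤n
^-deficit {l} {e} {K = K} {M} (suc x) refl eK≤Mt with ^-deficit x refl eK≤Mt
... | D , lˣ+D≡tˣ , DK≤ = e * l ^ x + t * D , eq , le
  where
  t : ℕ
  t = l + e
  eq : l * l ^ x + (e * l ^ x + t * D) ≡ t * t ^ x
  eq = begin
    l * l ^ x + (e * l ^ x + t * D) ≡⟨ factor l e (l ^ x) D ⟩
    t * (l ^ x + D)                 ≡⟨ cong (t *_) lˣ+D≡tˣ ⟩
    t * t ^ x                       ∎
    where
    open ≡-Reasoning
    factor : ∀ l e y D → l * y + (e * y + (l + e) * D) ≡ (l + e) * (y + D)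
    factor = solve-∀
  le : (e * l ^ x + t * D) * K ≤ suc x * M * (t * t ^ x)
  le = begin
    (e * l ^ x + t * D) * K             ≡⟨ distribute e (l ^ x) t D K ⟩
    e * K * l ^ x + t * (D * K)         ≤⟨ +-mono-≤ (*-mono-≤ eK≤Mt (^-monoˡ-≤ x (m≤m+n l e))) (*-monoʳ-≤ t DK≤) ⟩
    M * t * t ^ x + t * (x * M * t ^ x) ≡⟨ collect M t (t ^ x) x ⟩
    suc x * M * (t * t ^ x)             ∎
    where
    open ≤-Reasoning
    distribute : ∀ e y t D K → (e * y + t * D) * K ≡ e * K * y + t * (D * K)
    distribute = solve-∀
    collect : ∀ M t z x → M * t * z + t * (x * M * z) ≡ (1 + x) * M * (t * z)
    collect = solve-∀

toℚ-as-mkℚ : ∀ m → toℚ m ≡ mkℚ (+ m) 0 (coprime-sym (1-coprimeTo m))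
toℚ-as-mkℚ m = ℚ.normalize-coprime (coprime-sym (1-coprimeTo m))

toℚ-homo-+ : ∀ m n → toℚ (m + n) ≡ toℚ m +ℚ toℚ n
toℚ-homo-+ m n rewrite toℚ-as-mkℚ m | toℚ-as-mkℚ n | ℤ.*-identityʳ (+ m) | ℤ.*-identityʳ (+ n) = refl

toℚ-homo-* : ∀ m n → toℚ (m * n) ≡ toℚ m *ℚ toℚ n
toℚ-homo-* m n rewrite toℚ-as-mkℚ m | toℚ-as-mkℚ n = cong (_/ 1) (ℤ.pos-* m n)

toℚ-homo-^ : ∀ m n → toℚ (m ^ n) ≡ toℚ m ^ℚ n
toℚ-homo-^ m zero    = refl
toℚ-homo-^ m (suc n) = trans (toℚ-homo-* m (m ^ n)) (cong (toℚ m *ℚ_) (toℚ-homo-^ m n))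

toℚ-mono-≤ : ∀ {m n} → m ≤ n → toℚ m ≤ℚ toℚ n
toℚ-mono-≤ {m} {n} m≤n rewrite toℚ-as-mkℚ m | toℚ-as-mkℚ n =
  *≤* (subst₂ _≤ℤ_ (sym (ℤ.*-identityʳ (+ m))) (sym (ℤ.*-identityʳ (+ n))) (+≤+ m≤n))

toℚ-mono-< : ∀ {m n} → m < n → toℚ m <ℚ toℚ n
toℚ-mono-< {m} {n} m<n rewrite toℚ-as-mkℚ m | toℚ-as-mkℚ n =
  *<* (subst₂ _<ℤ_ (sym (ℤ.*-identityʳ (+ m))) (sym (ℤ.*-identityʳ (+ n))) (+<+ m<n))

toℚ-nonNeg : ∀ m → 0ℚ ≤ℚ toℚ m
toℚ-nonNeg m = toℚ-mono-≤ {0} {m} z≤n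

^ℚ-nonNeg : ∀ {r} n → 0ℚ ≤ℚ r → 0ℚ ≤ℚ r ^ℚ n
^ℚ-nonNeg     zero    _   = toℚ-nonNeg 1
^ℚ-nonNeg {r} (suc n) 0≤r = ℚ.nonNegative⁻¹ _
  {{ℚ.nonNeg*nonNeg⇒nonNeg r {{nonNegative 0≤r}} (r ^ℚ n) {{nonNegative (^ℚ-nonNeg n 0≤r)}}}}

^ℚ-monoˡ-≤ : ∀ {r s} n → 0ℚ ≤ℚ r → r ≤ℚ s → r ^ℚ n ≤ℚ s ^ℚ n
^ℚ-monoˡ-≤         zero    _   _   = ℚ.≤-refl
^ℚ-monoˡ-≤ {r} {s} (suc n) 0≤r r≤s = ℚ.≤-trans
  (ℚ.*-monoʳ-≤-nonNeg (r ^ℚ n) {{nonNegative (^ℚ-nonNeg n 0≤r)}} r≤s)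
  (ℚ.*-monoˡ-≤-nonNeg s {{nonNegative (ℚ.≤-trans 0≤r r≤s)}} (^ℚ-monoˡ-≤ n 0≤r r≤s))

relative-error : ∀ {B D A} K M → B + D ≡ A → 0 < A → D * K ≤ M * A →
  Σ ℚ λ ξ → toℚ B ≡ toℚ A *ℚ (1ℚ +ℚ ξ) × ∣ ξ ∣ℚ *ℚ toℚ K ≤ℚ toℚ M
relative-error {B} {D} {A} K M B+D≡A 0<A DK≤MA = ξ , B≡A[1+ξ] , ∣ξ∣K≤M
  where
  open +-*-Solver
  a d : ℚ
  a = toℚ A
  d = toℚ D
  instance
    a-pos : Positive a
    a-pos = positive (toℚ-mono-< 0<A)
    a-nonZero : NonZero a
    a-nonZero = ℚ.pos⇒nonZero a
  ξ : ℚ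
  ξ = - (d *ℚ 1/ a)
  a*1/a≡1 : a *ℚ 1/ a ≡ 1ℚ
  a*1/a≡1 = ℚ.*-inverseʳ a
  B≡A[1+ξ] : toℚ B ≡ a *ℚ (1ℚ +ℚ ξ)
  B≡A[1+ξ] = sym (begin
    a *ℚ (1ℚ +ℚ ξ)               ≡⟨ solve 3 (λ a d w → a :* (con 1ℚ :+ (:- (d :* w))) := a :- d :* (a :* w)) refl a d (1/ a) ⟩
    a +ℚ - (d *ℚ (a *ℚ 1/ a))    ≡⟨ cong (λ u → a +ℚ - (d *ℚ u)) a*1/a≡1 ⟩
    a +ℚ - (d *ℚ 1ℚ)             ≡⟨ cong (λ u → u +ℚ - (d *ℚ 1ℚ)) (trans (cong toℚ (sym B+D≡A)) (toℚ-homo-+ B D)) ⟩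
    toℚ B +ℚ d +ℚ - (d *ℚ 1ℚ)    ≡⟨ solve 2 (λ b d → b :+ d :- d :* con 1ℚ := b) refl (toℚ B) d ⟩
    toℚ B                        ∎)
    where open ≡-Reasoning
  ∣ξ∣≡d/a : ∣ ξ ∣ℚ ≡ d *ℚ 1/ a
  ∣ξ∣≡d/a = trans (ℚ.∣-p∣≡∣p∣ (d *ℚ 1/ a)) (ℚ.0≤p⇒∣p∣≡p (ℚ.nonNegative⁻¹ _))
    where
    instance
      _ = nonNegative (toℚ-nonNeg D)
      _ = ℚ.pos⇒nonNeg (1/ a) {{ℚ.1/pos⇒pos a}}
      _ = ℚ.nonNeg*nonNeg⇒nonNeg d (1/ a)
  ∣ξ∣K≤M : ∣ ξ ∣ℚ *ℚ toℚ K ≤ℚ toℚ M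
  ∣ξ∣K≤M = ℚ.*-cancelʳ-≤-pos a (begin
    ∣ ξ ∣ℚ *ℚ toℚ K *ℚ a         ≡⟨ cong (λ u → u *ℚ toℚ K *ℚ a) ∣ξ∣≡d/a ⟩
    d *ℚ 1/ a *ℚ toℚ K *ℚ a      ≡⟨ solve 4 (λ d w k a → d :* w :* k :* a := d :* k :* (a :* w)) refl d (1/ a) (toℚ K) a ⟩
    d *ℚ toℚ K *ℚ (a *ℚ 1/ a)    ≡⟨ cong (d *ℚ toℚ K *ℚ_) a*1/a≡1 ⟩
    d *ℚ toℚ K *ℚ 1ℚ             ≡⟨ ℚ.*-identityʳ _ ⟩
    d *ℚ toℚ K                   ≡⟨ sym (toℚ-homo-* D K) ⟩
    toℚ (D * K)                  ≤⟨ toℚ-mono-≤ DK≤MA ⟩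
    toℚ (M * A)                  ≡⟨ toℚ-homo-* M A ⟩
    toℚ M *ℚ a                   ∎)
    where open ℚ.≤-Reasoning

^ℚ-<-toℚ : ∀ {r} M {R} q → 0ℚ ≤ℚ r → r ≤ℚ toℚ M → M ^ q < R → r ^ℚ q <ℚ toℚ R
^ℚ-<-toℚ {r} M {R} q 0≤r r≤M Mᵠ<R = begin-strict
  r ^ℚ q      ≤⟨ ^ℚ-monoˡ-≤ q 0≤r r≤M ⟩
  toℚ M ^ℚ q  ≡⟨ sym (toℚ-homo-^ M q) ⟩
  toℚ (M ^ q) <⟨ toℚ-mono-< Mᵠ<R ⟩
  toℚ R       ∎
  where open ℚ.≤-Reasoning

+m≤i⇒m≤∣i∣ : ∀ {m i} → + m ≤ℤ i → m ≤ ∣ i ∣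
+m≤i⇒m≤∣i∣ (+≤+ m≤n) = m≤n

lucasRev-suc : ∀ k m → lucasRev k (suc m) ≡ L k (suc m) ∷ lucasRev k m
lucasRev-suc k zero    = refl
lucasRev-suc k (suc m) = refl

length-lucasRev : ∀ k m → length (lucasRev k m) ≡ suc m
length-lucasRev k zero    = refl
length-lucasRev k (suc m) rewrite lucasRev-suc k m = cong suc (length-lucasRev k m)

drop-lucasRev : ∀ k j r → drop j (lucasRev k (j + r)) ≡ lucasRev k r
drop-lucasRev k zero    r = refl
drop-lucasRev k (suc j) r rewrite lucasRev-suc k (j + r) = drop-lucasRev k j r

drop-lucasRev-beyond : ∀ k {m j} → m < j → drop j (lucasRev k m) ≡ []
drop-lucasRev-beyond k {m} {j} m<j =
  drop-all j (lucasRev k m) (subst (_≤ j) (sym (length-lucasRev k m)) m<j)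

-- L_{n+3} = 2 L_{n+2} - L_{n+1-j}, where the last term is 0 when n + 1 < j.
L-recurrence : ∀ j n →
  L (suc j) (3 + n) + headOr0 (drop j (lucasRev (suc j) (suc n))) ≡ 2 * L (suc j) (2 + n)
L-recurrence j n = begin
  S + sum (take j ys) + headOr0 (drop j ys)   ≡⟨ +-assoc S _ _ ⟩
  S + (sum (take j ys) + headOr0 (drop j ys)) ≡⟨ cong (_+_ S) (sym (sum-take-suc j ys)) ⟩
  S + S                                       ≡⟨ cong (_+_ S) (sym (+-identityʳ S)) ⟩
  2 * S                                       ∎
  where
  open ≡-Reasoning
  ys : List ℕ
  ys = lucasRev (suc j) (suc n)
  S : ℕ
  S = sum (take (suc j) ys)

2*[3*2^m]≡3*2^[1+m] : ∀ m → 2 * (3 * 2 ^ m) ≡ 3 * 2 ^ suc m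
2*[3*2^m]≡3*2^[1+m] m = trans (sym (*-assoc 2 3 (2 ^ m))) (*-assoc 3 2 (2 ^ m))

L[2+m]≡3*2^m : ∀ {k} m → 2 + m ≤ k → L k (2 + m) ≡ 3 * 2 ^ m
L[2+m]≡3*2^m {suc (suc zero)}    zero    _           = refl
L[2+m]≡3*2^m {suc (suc (suc _))} zero    _           = refl
L[2+m]≡3*2^m {suc j}             (suc m) (s≤s 2+m≤j) = begin
  L (suc j) (3 + m)                                    ≡⟨ sym (+-identityʳ _) ⟩
  L (suc j) (3 + m) + headOr0 []                       ≡⟨ cong (λ ys → L (suc j) (3 + m) + headOr0 ys) beyond ⟩
  L (suc j) (3 + m) + headOr0 (drop j (lucasRev (suc j) (suc m))) ≡⟨ L-recurrence j m ⟩
  2 * L (suc j) (2 + m)                                ≡⟨ cong (2 *_) (L[2+m]≡3*2^m m (m≤n⇒m≤1+n 2+m≤j)) ⟩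
  2 * (3 * 2 ^ m)                                      ≡⟨ 2*[3*2^m]≡3*2^[1+m] m ⟩
  3 * 2 ^ suc m                                        ∎
  where
  open ≡-Reasoning
  beyond : [] ≡ drop j (lucasRev (suc j) (suc m))
  beyond = sym (drop-lucasRev-beyond (suc j) 2+m≤j)

L≤2^[1+m] : ∀ j m → L (2 + j) m ≤ 2 ^ suc m
L≤2^[1+m] j zero                = ≤-refl
L≤2^[1+m] j (suc zero)          = s≤s z≤n
L≤2^[1+m] j (suc (suc zero))    = subst (_≤ 8) (sym (L[2+m]≡3*2^m {2 + j} 0 (s≤s (s≤s z≤n)))) (s≤s (s≤s (s≤s z≤n)))
L≤2^[1+m] j (suc (suc (suc n))) = begin
  L (2 + j) (3 + n)                                                     ≤⟨ m≤m+n _ _ ⟩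
  L (2 + j) (3 + n) + headOr0 (drop (suc j) (lucasRev (2 + j) (suc n))) ≡⟨ L-recurrence (suc j) n ⟩
  2 * L (2 + j) (2 + n)                                                 ≤⟨ *-monoʳ-≤ 2 (L≤2^[1+m] j (suc (suc n))) ⟩
  2 ^ (4 + n)                                                           ∎
  where open ≤-Reasoning

L-deficit : ∀ j d → ∃[ E ] L (2 + j) (2 + j + d) + E ≡ 3 * 2 ^ (j + d) × E ≤ d * 2 ^ d
L-deficit j zero rewrite +-identityʳ j = 0 , trans (+-identityʳ _) (L[2+m]≡3*2^m j ≤-refl) , z≤n
L-deficit j (suc d) with L-deficit j d
... | E , L+E≡ , E≤ rewrite +-suc j d = 2 * E + L k d , L+E′≡ , E′≤
  where
  k m : ℕ
  k = 2 + j
  m = j + d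
  L+E′≡ : L k (3 + m) + (2 * E + L k d) ≡ 3 * 2 ^ suc m
  L+E′≡ = begin
    L k (3 + m) + (2 * E + L k d)                                       ≡⟨ regroup (L k (3 + m)) E (L k d) ⟩
    L k (3 + m) + L k d + 2 * E                                         ≡⟨ cong (λ ys → L k (3 + m) + headOr0 ys + 2 * E) (sym (drop-lucasRev k (suc j) d)) ⟩
    L k (3 + m) + headOr0 (drop (suc j) (lucasRev k (suc m))) + 2 * E ≡⟨ cong (_+ 2 * E) (L-recurrence (suc j) m) ⟩
    2 * L k (2 + m) + 2 * E                                             ≡⟨ sym (*-distribˡ-+ 2 (L k (2 + m)) E) ⟩
    2 * (L k (2 + m) + E)                                               ≡⟨ cong (2 *_) L+E≡ ⟩
    2 * (3 * 2 ^ m)                                                     ≡⟨ 2*[3*2^m]≡3*2^[1+m] m ⟩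
    3 * 2 ^ suc m                                                       ∎
    where
    open ≡-Reasoning
    regroup : ∀ a e l → a + (2 * e + l) ≡ a + l + 2 * e
    regroup = solve-∀
  E′≤ : 2 * E + L k d ≤ suc d * 2 ^ suc d
  E′≤ = begin
    2 * E + L k d               ≤⟨ +-mono-≤ (*-monoʳ-≤ 2 E≤) (L≤2^[1+m] j d) ⟩
    2 * (d * 2 ^ d) + 2 ^ suc d ≡⟨ factor d (2 ^ d) ⟩
    suc d * 2 ^ suc d           ∎
    where
    open ≤-Reasoning
    factor : ∀ d p → 2 * (d * p) + 2 * p ≡ (1 + d) * (2 * p)
    factor = solve-∀

L-relative-deficit : ∀ {k N} → 2 ≤ k → k ≤ N →
  ∃[ E ] L k N + E ≡ 3 * 2 ^ (N ∸ 2) × E * 2 ^ (k ∸ 1) ≤ N * (3 * 2 ^ (N ∸ 2))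
L-relative-deficit {suc (suc j)} {N} (s≤s (s≤s _)) k≤N with N ∸ (2 + j) | m+[n∸m]≡n k≤N
... | d | refl with L-deficit j d
...   | E , L+E≡ , E≤ = E , L+E≡ , (begin
  E * 2 ^ suc j                   ≤⟨ *-monoˡ-≤ (2 ^ suc j) E≤ ⟩
  d * 2 ^ d * 2 ^ suc j           ≡⟨ *-assoc d (2 ^ d) (2 ^ suc j) ⟩
  d * (2 ^ d * 2 ^ suc j)         ≡⟨ cong (d *_) (sym (^-distribˡ-+-* 2 d (suc j))) ⟩
  d * 2 ^ (d + suc j)             ≡⟨ cong (λ e → d * 2 ^ e) (trans (+-suc d j) (cong suc (+-comm d j))) ⟩
  d * (2 * 2 ^ (j + d))           ≤⟨ *-mono-≤ (m≤n+m d (2 + j)) (*-monoˡ-≤ (2 ^ (j + d)) (n≤1+n 2)) ⟩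
  (2 + j + d) * (3 * 2 ^ (j + d)) ∎)
  where open ≤-Reasoning

L^x-relative-deficit : ∀ {k N} x → 2 ≤ k → k ≤ N →
  ∃[ D ] L k N ^ x + D ≡ 3 ^ x * 2 ^ ((N ∸ 2) * x)
       × D * 2 ^ (k ∸ 1) ≤ x * N * (3 ^ x * 2 ^ ((N ∸ 2) * x))
L^x-relative-deficit {k} {N} x 2≤k k≤N with L-relative-deficit 2≤k k≤N
... | E , L+E≡T , E≤ with ^-deficit x L+E≡T E≤
... | D , Lˣ+D≡Tˣ , D≤ = D , trans Lˣ+D≡Tˣ Tˣ≡ , subst (λ A → D * 2 ^ (k ∸ 1) ≤ x * N * A) Tˣ≡ D≤
  where
  Tˣ≡ : (3 * 2 ^ (N ∸ 2)) ^ x ≡ 3 ^ x * 2 ^ ((N ∸ 2) * x)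
  Tˣ≡ = trans (^-distribʳ-* 3 (2 ^ (N ∸ 2)) x) (cong (3 ^ x *_) (^-*-assoc 2 (N ∸ 2) x))

L^x-relative-error : ∀ {k N} x → 2 ≤ k → k ≤ N →
  Σ ℚ λ ξ → toℚ (L k N ^ x) ≡ toℚ (3 ^ x * 2 ^ ((N ∸ 2) * x)) *ℚ (1ℚ +ℚ ξ)
          × ∣ ξ ∣ℚ *ℚ toℚ (2 ^ (k ∸ 1)) ≤ℚ toℚ (x * N)
L^x-relative-error {k} {N} x 2≤k k≤N with L^x-relative-deficit x 2≤k k≤N
... | D , Lˣ+D≡A , D≤ = relative-error {L k N ^ x} {D} (2 ^ (k ∸ 1)) (x * N) Lˣ+D≡A A>0 D≤
  where
  A>0 : 0 < 3 ^ x * 2 ^ ((N ∸ 2) * x)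
  A>0 = *-mono-< (m^n>0 3 x) (m^n>0 2 ((N ∸ 2) * x))

lemma2p3 : (x k p q : ℕ) (i n : ℤ) →
    x ≥ 1 → k ≥ 2 →
    (i ≡ -[1+ 0 ] ⊎ i ≡ + 0 ⊎ i ≡ + 1) →
    + (k + 2) ≤ℤ n +ℤ i →
    1 ≤ p → 4 * p < q →
    ∣ n +ℤ i ∣ ^ q < 2 ^ (p * k) →
    (16 * x) ^ q < 2 ^ (p * k) →
    Σ ℚ (λ ξ →
      (toℚ (L k ∣ n +ℤ i ∣ ^ x)
        ≡ toℚ (3 ^ x * 2 ^ ((∣ n +ℤ i ∣ ∸ 2) * x)) *ℚ (1ℚ +ℚ ξ))
      × ((∣ ξ ∣ℚ *ℚ toℚ (2 ^ (k ∸ 1))) ^ℚ q <ℚ toℚ (2 ^ (2 * p * k))))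
lemma2p3 x k p q i n _ 2≤k _ k+2≤n+i _ _ Nᵠ< 16xᵠ< =
  let ξ , Lˣ≡A[1+ξ] , ∣ξ∣K≤xN = L^x-relative-error x 2≤k k≤N
  in  ξ , Lˣ≡A[1+ξ] , ^ℚ-<-toℚ (x * N) q (∣ξ∣K≥0 ξ) ∣ξ∣K≤xN xNᵠ<
  where
  N : ℕ
  N = ∣ n +ℤ i ∣
  k≤N : k ≤ N
  k≤N = ≤-trans (m≤m+n k 2) (+m≤i⇒m≤∣i∣ k+2≤n+i)
  ∣ξ∣K≥0 : ∀ ξ → 0ℚ ≤ℚ ∣ ξ ∣ℚ *ℚ toℚ (2 ^ (k ∸ 1))
  ∣ξ∣K≥0 ξ = ℚ.nonNegative⁻¹ _
    {{ℚ.nonNeg*nonNeg⇒nonNeg ∣ ξ ∣ℚ {{ℚ.∣-∣-nonNeg ξ}} _ {{nonNegative (toℚ-nonNeg (2 ^ (k ∸ 1)))}}}}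
  2ᵖᵏ*2ᵖᵏ≡2²ᵖᵏ : 2 ^ (p * k) * 2 ^ (p * k) ≡ 2 ^ (2 * p * k)
  2ᵖᵏ*2ᵖᵏ≡2²ᵖᵏ = trans (sym (^-distribˡ-+-* 2 (p * k) (p * k)))
    (cong (2 ^_) (trans (cong (_+_ (p * k)) (sym (+-identityʳ (p * k)))) (sym (*-assoc 2 p k))))
  xNᵠ< : (x * N) ^ q < 2 ^ (2 * p * k)
  xNᵠ< = ≤-<-trans (^-monoˡ-≤ q (*-monoˡ-≤ N (m≤n*m x 16)))
    (subst ((16 * x * N) ^ q <_) 2ᵖᵏ*2ᵖᵏ≡2²ᵖᵏ (^-<-square q 16xᵠ< Nᵠ<))
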